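{- There exists a function $f:\mathbb N\to\mathbb N$ such that the following holds. Let $G$ be a graph, $F=(\iota,\tau)$ a $k$-flip on $V(G)$, and $I$ an independent set of $G$. Then there exist a partition $I_1,\dots,I_p$ of $I$ into at most $2k$ parts and an $f(k)$-flip $F'$ on $V(G)$ such that $G\oplus F'\ast I_p\ast\dots\ast I_1=G\ast I\oplus F$ (in particular each $I_j$ is independent in the graph to which it is applied).
   Context: Graphs are finite and simple; adjacency $E_G(u,v)\in\mathrm{GF}(2)$. A $k$-flip on $V$ is $F=(\iota,\tau)$ with $\iota:V\to[k]$ and $\tau:[k]\times[k]\to\mathrm{GF}(2)$ symmetric; $G\oplus F$ has $E_{G\oplus F}(x,y)=E_G(x,y)+\tau(\iota(x),\iota(y))$ for distinct $x,y$. For a vertex $v$, $E_{G\ast v}(x,y)=E_G(x,y)+E_G(x,v)E_G(v,y)$; for a set $J$ independent in the current graph, $\ast J$ denotes successive local complementation of all vertices of $J$; the notation $H\ast J$ is only used when $J$ is independent in $H$. Expressions are evaluated left to right. -}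

module Defs where

open import Data.Nat using (ℕ; zero; suc)
open import Data.Fin using (Fin; fromℕ; inject₁; _≟_)
open import Data.Bool using (Bool; true; false; _xor_; _∧_; if_then_else_)
open import Data.List using (allFin; foldl)
open import Data.Product using (Σ; ∃; _×_; _,_)
open import Data.Unit using (⊤)
open import Relation.Nullary using (does)
open import Relation.Binary.PropositionalEquality using (_≡_)

-- Adjacency over GF(2) = Bool (with _xor_ as addition, _∧_ as multiplication)
-- on vertex set Fin n.
Adj : ℕ → Set
Adj n = Fin n → Fin n → Bool

IsSimpleGraph : ∀ {n} → Adj n → Set
IsSimpleGraph {n} E = (∀ x y → E x y ≡ E y x) × (∀ x → E x x ≡ false)

VSet : ℕ → Set
VSet n = Fin n → Bool

_≈G_ : ∀ {n} → Adj n → Adj n → Set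
E ≈G E' = ∀ x y → E x y ≡ E' x y

record Flip (n k : ℕ) : Set where
  field
    ι     : Fin n → Fin k
    τ     : Fin k → Fin k → Bool
    τ-sym : ∀ i j → τ i j ≡ τ j i
open Flip public

_⊕_ : ∀ {n k} → Adj n → Flip n k → Adj n
(E ⊕ F) x y = if does (x ≟ y) then E x y else (E x y xor τ F (ι F x) (ι F y))

_∗v_ : ∀ {n} → Adj n → Fin n → Adj n
(E ∗v v) x y = if does (x ≟ y) then E x y else (E x y xor (E x v ∧ E v y))

Independent : ∀ {n} → Adj n → VSet n → Set
Independent E J = ∀ x y → J x ≡ true → J y ≡ true → E x y ≡ false

-- Successive local complementation at all vertices of J
-- (in increasing vertex order; for independent J the order is irrelevant).
_∗_ : ∀ {n} → Adj n → VSet n → Adj n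
_∗_ {n} E J = foldl (λ H v → if J v then H ∗v v else H) E (allFin n)

-- H ∗ I_p ∗ … ∗ I_1 for parts I : Fin p → VSet n (I_j = I (j-1)).
applyParts : ∀ {n} (p : ℕ) → Adj n → (Fin p → VSet n) → Adj n
applyParts zero    H I = H
applyParts (suc p) H I = applyParts p (H ∗ I (fromℕ p)) (λ j → I (inject₁ j))

PartsIndependent : ∀ {n} (p : ℕ) → Adj n → (Fin p → VSet n) → Set
PartsIndependent zero    H I = ⊤
PartsIndependent (suc p) H I =
  Independent H (I (fromℕ p)) ×
  PartsIndependent p (H ∗ I (fromℕ p)) (λ j → I (inject₁ j))

IsPartition : ∀ {n} (p : ℕ) → (Fin p → VSet n) → VSet n → Set
IsPartition {n} p I J =
  (∀ j → ∃ λ v → I j v ≡ true) ×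
  (∀ j v → I j v ≡ true → J v ≡ true) ×
  (∀ v → J v ≡ true → ∃ λ j → I j v ≡ true × (∀ j' → I j' v ≡ true → j' ≡ j))

{-# OPTIONS --safe #-}

-- Let T = G ∗ I ⊕ F. The colour classes of F are peeled off one at a time, keeping
-- T ∗ J₁ ∗ ⋯ ∗ Jᵢ = G ∗ R ⊕ Φ, where R ⊆ I is the unpeeled part and the labels of the flip Φ
-- on R depend only on the F-colour. In G ∗ R ⊕ Φ a colour class of R is therefore independent
-- or a clique; complementing at one vertex of a clique makes the rest of the class independent,
-- so each colour costs at most two parts. Complementing at an independent set J of equally
-- labelled vertices commutes with the flip once the labels are refined by membership in J and
-- by the parity of the number of neighbours in J; this multiplies the number of labels by 4, and
-- gives f(k) = k·16^k. Since ∗J is an involution when J is independent, applying the parts in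
-- reverse order to G ⊕ F′ gives back T.

module Submission where

open import Defs
open import Algebra.Bundles using (CommutativeRing)
open import Data.Bool using (Bool; true; false; not; _∧_; _xor_; if_then_else_)
open import Data.Bool.Properties
  using ( xor-∧-commutativeRing; xor-assoc; xor-identityʳ; ∧-zeroʳ; ∧-identityʳ; ∧-inverseʳ
        ; ∧-conicalˡ; ∧-conicalʳ; ∧-comm; ∧-distribʳ-xor)
  renaming (_≟_ to _≟ᵇ_)
open import Data.Fin using (Fin; zero; suc; _≟_; fromℕ; inject₁)
open import Data.Fin.Properties using (any?; *↔×; 2↔Bool)
open import Data.List using (List; []; _∷_; foldl; length; lookup; tabulate; allFin)
open import Data.List.Properties using (length-tabulate)
open import Data.List.Membership.Propositional using (_∈_)
open import Data.List.Membership.Propositional.Properties using (∈-allFin)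
open import Data.List.Relation.Unary.Any using (here; there)
open import Data.Maybe using (nothing)
open import Data.Nat using (ℕ; zero; suc; _≤_; _*_; _^_; z≤n; s≤s)
open import Data.Nat.Properties using (*-suc; *-assoc; *-identityʳ; m≤n⇒m≤1+n)
open import Data.Product using (Σ; ∃; _×_; _,_; proj₂)
open import Data.Product.Function.NonDependent.Propositional using (_×-↪_; _×-↔_)
open import Data.Unit using (tt)
open import Function using (_∘_; id)
open import Function.Bundles using (_↪_; module RightInverse)
open import Function.Construct.Composition using (_↪-∘_; _↔-∘_)
open import Function.Construct.Identity using (↪-id)
open import Function.Construct.Symmetry using (↔-sym)
open import Function.Properties.Inverse using (↔⇒↪)
open import Level using (0ℓ)
open import Relation.Binary.Bundles using (Setoid)
open import Relation.Binary.PropositionalEquality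
open import Relation.Nullary using (does; yes; no; contradiction)
open import Relation.Nullary.Decidable using (dec-true; dec-false)
open import Tactic.RingSolver using (solve-∀)
open import Tactic.RingSolver.Core.AlmostCommutativeRing using (AlmostCommutativeRing; fromCommutativeRing)
open import Algebra.Properties.Semiring.Sum (CommutativeRing.semiring xor-∧-commutativeRing)
  using (sum; ∑-distrib-+; *-distribˡ-sum; sum-cong-≗; sum-replicate-zero)

open ≡-Reasoning

𝔽₂ : AlmostCommutativeRing 0ℓ 0ℓ
𝔽₂ = fromCommutativeRing xor-∧-commutativeRing (λ _ → nothing)

∧-congˡ-if : ∀ j {a b} → (j ≡ true → a ≡ b) → j ∧ a ≡ j ∧ b
∧-congˡ-if false _   = refl
∧-congˡ-if true  a≡b = a≡b refl

sum-zero : ∀ {n} {f : Fin n → Bool} → (∀ v → f v ≡ false) → sum f ≡ false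
sum-zero {n} f≡false = trans (sum-cong-≗ f≡false) (sum-replicate-zero n)

sum-∧-cong : ∀ {n} (J : Fin n → Bool) {f g : Fin n → Bool} →
             (∀ v → J v ≡ true → f v ≡ g v) → sum (λ v → J v ∧ f v) ≡ sum (λ v → J v ∧ g v)
sum-∧-cong J f≡g = sum-cong-≗ (λ v → ∧-congˡ-if (J v) (f≡g v))

sum-∧-zero : ∀ {n} (J : Fin n → Bool) {f : Fin n → Bool} →
             (∀ v → J v ≡ true → f v ≡ false) → sum (λ v → J v ∧ f v) ≡ false
sum-∧-zero J f≡false = trans (sum-∧-cong J f≡false) (sum-zero (λ v → ∧-zeroʳ (J v)))

sum-∧-affine : ∀ {n} (J p q : Fin n → Bool) a b →
  sum (λ v → J v ∧ ((p v xor a) ∧ (q v xor b)))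
  ≡ (sum (λ v → J v ∧ (p v ∧ q v)) xor (a ∧ sum (λ v → J v ∧ q v)))
    xor ((b ∧ sum (λ v → J v ∧ p v)) xor (a ∧ (b ∧ sum J)))
sum-∧-affine J p q a b = begin
  sum (λ v → J v ∧ ((p v xor a) ∧ (q v xor b)))
    ≡⟨ sum-cong-≗ (λ v → expand (J v) (p v) (q v) a b) ⟩
  sum (λ v → (f₁ v xor f₂ v) xor (f₃ v xor f₄ v))
    ≡⟨ ∑-distrib-+ (λ v → f₁ v xor f₂ v) (λ v → f₃ v xor f₄ v) ⟩
  sum (λ v → f₁ v xor f₂ v) xor sum (λ v → f₃ v xor f₄ v)
    ≡⟨ cong₂ _xor_ (∑-distrib-+ f₁ f₂) (∑-distrib-+ f₃ f₄) ⟩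
  (sum f₁ xor sum f₂) xor (sum f₃ xor sum f₄)
    ≡⟨ cong₂ (λ s₂ s₃₄ → (sum f₁ xor s₂) xor s₃₄)
         (sym (*-distribˡ-sum a (λ v → J v ∧ q v)))
         (cong₂ _xor_ (sym (*-distribˡ-sum b (λ v → J v ∧ p v)))
                      (trans (sym (*-distribˡ-sum a (λ v → b ∧ J v)))
                             (cong (a ∧_) (sym (*-distribˡ-sum b J))))) ⟩
  (sum f₁ xor (a ∧ sum (λ v → J v ∧ q v))) xor ((b ∧ sum (λ v → J v ∧ p v)) xor (a ∧ (b ∧ sum J)))
    ∎
  where
  f₁ f₂ f₃ f₄ : Fin _ → Bool
  f₁ v = J v ∧ (p v ∧ q v)
  f₂ v = a ∧ (J v ∧ q v)
  f₃ v = b ∧ (J v ∧ p v)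
  f₄ v = a ∧ (b ∧ J v)
  expand : ∀ j x y a b →
    j ∧ ((x xor a) ∧ (y xor b)) ≡ ((j ∧ (x ∧ y)) xor (a ∧ (j ∧ y))) xor ((b ∧ (j ∧ x)) xor (a ∧ (b ∧ j)))
  expand = solve-∀ 𝔽₂

parity : ∀ {n} → (Fin n → Bool) → Bool
parity = sum

_⊆_ : ∀ {n} → VSet n → VSet n → Set
J ⊆ R = ∀ x → J x ≡ true → R x ≡ true

⊆-refl : ∀ {n} {J : VSet n} → J ⊆ J
⊆-refl _ Jx = Jx

_∖_ : ∀ {n} → VSet n → VSet n → VSet n
(R ∖ J) x = R x ∧ not (J x)

Empty : ∀ {n} → VSet n → Set
Empty R = ∀ x → R x ≡ false

∖-⊆ : ∀ {n} {R J : VSet n} → (R ∖ J) ⊆ R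
∖-⊆ {R = R} x = ∧-conicalˡ (R x) _

∈-∖⁻ : ∀ {n} (R J : VSet n) x → (R ∖ J) x ≡ true → R x ≡ true × J x ≡ false
∈-∖⁻ R J x x∈ with R x | J x
∈-∖⁻ R J x refl | true  | false = refl , refl
∈-∖⁻ R J x ()   | true  | true
∈-∖⁻ R J x ()   | false | _

∈-∖⁺ : ∀ {n} (R J : VSet n) {x} → R x ≡ true → J x ≡ false → (R ∖ J) x ≡ true
∈-∖⁺ R J Rx Jx = cong₂ (λ r j → r ∧ not j) Rx Jx

∖-xor : ∀ {n} {R J : VSet n} → J ⊆ R → ∀ x → (R ∖ J) x ≡ R x xor J x
∖-xor {R = R} {J} J⊆R x with J x in Jx
... | true  rewrite J⊆R x Jx = refl
... | false = trans (∧-identityʳ (R x)) (sym (xor-identityʳ (R x)))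

∖-empty : ∀ {n} {R J : VSet n} → Empty J → ∀ x → (R ∖ J) x ≡ R x
∖-empty {R = R} J-empty x = trans (cong (λ j → R x ∧ not j) (J-empty x)) (∧-identityʳ (R x))

does-≟⇒≡ : ∀ {n} {x y : Fin n} → does (x ≟ y) ≡ true → x ≡ y
does-≟⇒≡ {x = x} {y} h with x ≟ y
... | yes x≡y = x≡y
... | no  _   = contradiction h λ ()

if-≟-refl : ∀ {n} {A : Set} (x : Fin n) {t e : A} → (if does (x ≟ x) then t else e) ≡ t
if-≟-refl x rewrite dec-true (x ≟ x) refl = refl

if-≟-≢ : ∀ {n} {A : Set} {x y : Fin n} {t e : A} → x ≢ y → (if does (x ≟ y) then t else e) ≡ e
if-≟-≢ {x = x} {y} x≢y rewrite dec-false (x ≟ y) x≢y = refl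

pick : ∀ {n} → VSet n → VSet n
pick P with any? (λ v → P v ≟ᵇ true)
... | yes (v , _) = λ x → does (x ≟ v)
... | no  _       = λ _ → false

pick-⊆ : ∀ {n} {P : VSet n} → pick P ⊆ P
pick-⊆ {P = P} x x∈ with any? (λ v → P v ≟ᵇ true)
... | yes (v , Pv) = subst (λ z → P z ≡ true) (sym (does-≟⇒≡ x∈)) Pv

pick-subsingleton : ∀ {n} {P : VSet n} x y → pick P x ≡ true → pick P y ≡ true → x ≡ y
pick-subsingleton {P = P} x y x∈ y∈ with any? (λ v → P v ≟ᵇ true)
... | yes (v , _) = trans (does-≟⇒≡ x∈) (sym (does-≟⇒≡ y∈))

parity-singleton : ∀ {n} (v : Fin n) → parity (λ x → does (x ≟ v)) ≡ true
parity-singleton {suc n} zero    = cong not (sum-replicate-zero n)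
parity-singleton         (suc v) = parity-singleton v

parity-pick : ∀ {n} {P : VSet n} {u} → P u ≡ true → parity (pick P) ≡ true
parity-pick {P = P} {u} Pu with any? (λ v → P v ≟ᵇ true)
... | yes (v , _) = parity-singleton v
... | no  ∄       = contradiction (u , Pu) ∄

Symmetric : ∀ {n} → Adj n → Set
Symmetric E = ∀ x y → E x y ≡ E y x

≈G-setoid : ℕ → Setoid 0ℓ 0ℓ
≈G-setoid n = record
  { Carrier       = Adj n
  ; _≈_           = _≈G_
  ; isEquivalence = record
    { refl  = λ _ _ → refl
    ; sym   = λ E≈E′ x y → sym (E≈E′ x y)
    ; trans = λ E≈E′ E′≈E″ x y → trans (E≈E′ x y) (E′≈E″ x y)
    }
  }

module ≈G {n : ℕ} = Setoid (≈G-setoid n)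

≈G-by-cases : ∀ {n} {E E′ : Adj n} →
              (∀ x → E x x ≡ E′ x x) → (∀ {x y} → x ≢ y → E x y ≡ E′ x y) → E ≈G E′
≈G-by-cases diag off x y with x ≟ y
... | yes refl = diag x
... | no  x≢y  = off x≢y

independent-⊆ : ∀ {n} {K : Adj n} {R J : VSet n} → J ⊆ R → Independent K R → Independent K J
independent-⊆ J⊆R R-ind x y Jx Jy = R-ind x y (J⊆R x Jx) (J⊆R y Jy)

independent-≈ : ∀ {n} {K K′ : Adj n} {J : VSet n} → K ≈G K′ → Independent K J → Independent K′ J
independent-≈ K≈K′ J-ind x y Jx Jy = trans (sym (K≈K′ x y)) (J-ind x y Jx Jy)

empty-independent : ∀ {n} {K : Adj n} {J : VSet n} → Empty J → Independent K J
empty-independent J-empty x _ Jx _ = contradiction (trans (sym Jx) (J-empty x)) λ ()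

subsingleton-independent : ∀ {n} {K : Adj n} {J : VSet n} → (∀ x → K x x ≡ false) →
  (∀ x y → J x ≡ true → J y ≡ true → x ≡ y) → Independent K J
subsingleton-independent K-irr J-sub x y Jx Jy rewrite J-sub x y Jx Jy = K-irr y

-- Degrees are counted modulo 2.
degree : ∀ {n} → Adj n → VSet n → Fin n → Bool
degree K J x = sum (λ v → J v ∧ K x v)

codegree : ∀ {n} → Adj n → VSet n → Fin n → Fin n → Bool
codegree K J x y = sum (λ v → J v ∧ (K x v ∧ K v y))

codegree-zeroˡ : ∀ {n} (K : Adj n) (J : VSet n) {x y} →
                 (∀ v → J v ≡ true → K x v ≡ false) → codegree K J x y ≡ false
codegree-zeroˡ K J {y = y} Kx≡false = sum-∧-zero J (λ v Jv → cong (_∧ K v y) (Kx≡false v Jv))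

codegree-zeroʳ : ∀ {n} (K : Adj n) (J : VSet n) {x y} →
                 (∀ v → J v ≡ true → K v y ≡ false) → codegree K J x y ≡ false
codegree-zeroʳ K J {x} K≡false =
  sum-∧-zero J (λ v Jv → trans (cong (K x v ∧_) (K≡false v Jv)) (∧-zeroʳ (K x v)))

codegree-∖ : ∀ {n} (K : Adj n) {R J : VSet n} → J ⊆ R → ∀ x y →
             codegree K (R ∖ J) x y ≡ codegree K R x y xor codegree K J x y
codegree-∖ K {R} {J} J⊆R x y =
  trans (sum-cong-≗ (λ v → trans (cong (_∧ (K x v ∧ K v y)) (∖-xor J⊆R v))
                                 (∧-distribʳ-xor (K x v ∧ K v y) (R v) (J v))))
        (∑-distrib-+ (λ v → R v ∧ (K x v ∧ K v y)) (λ v → J v ∧ (K x v ∧ K v y)))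

-- Local complementation at independent sets

∗v-diag : ∀ {n} (K : Adj n) u x → (K ∗v u) x x ≡ K x x
∗v-diag K u x = if-≟-refl x

∗v-off : ∀ {n} (K : Adj n) u {x y} → x ≢ y → (K ∗v u) x y ≡ K x y xor (K x u ∧ K u y)
∗v-off K u = if-≟-≢

∗v-cong : ∀ {n} {K K′ : Adj n} {u} → K ≈G K′ → (K ∗v u) ≈G (K′ ∗v u)
∗v-cong {u = u} K≈K′ x y rewrite K≈K′ x y | K≈K′ x u | K≈K′ u y = refl

∗v-fixesʳ : ∀ {n} (K : Adj n) u {x v} → K u v ≡ false → (K ∗v u) x v ≡ K x v
∗v-fixesʳ K u {x} {v} Kuv≡false with x ≟ v
... | yes refl = refl
... | no  _ rewrite Kuv≡false | ∧-zeroʳ (K x u) = xor-identityʳ (K x v)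

∗v-fixesˡ : ∀ {n} (K : Adj n) u {v x} → K v u ≡ false → (K ∗v u) v x ≡ K v x
∗v-fixesˡ K u {v} {x} Kvu≡false with v ≟ x
... | yes refl = refl
... | no  _ rewrite Kvu≡false = xor-identityʳ (K v x)

-- Since J is independent, a step at a vertex of J leaves all edges at J unchanged, so every step
-- contributes its term as computed in the original graph. The fold over allFin n = tabulate id
-- is treated as one over tabulate f, for the sake of the induction.
private
  module Fold {n : ℕ} (J : VSet n) where
    step : Adj n → Fin n → Adj n
    step H v = if J v then H ∗v v else H

    step-diag : ∀ K u x → step K u x x ≡ K x x
    step-diag K u x with J u
    ... | true  = ∗v-diag K u x
    ... | false = refl

    step-off : ∀ K u {x y} → x ≢ y → step K u x y ≡ K x y xor (J u ∧ (K x u ∧ K u y))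
    step-off K u x≢y with J u
    ... | true  = ∗v-off K u x≢y
    ... | false = sym (xor-identityʳ _)

    step-cong : ∀ {K K′} u → K ≈G K′ → step K u ≈G step K′ u
    step-cong u K≈K′ with J u
    ... | true  = ∗v-cong K≈K′
    ... | false = K≈K′

    step-fixesʳ : ∀ {K} u {x v} → Independent K J → J v ≡ true → step K u x v ≡ K x v
    step-fixesʳ {K} u J-ind Jv with J u in Ju
    ... | true  = ∗v-fixesʳ K u (J-ind u _ Ju Jv)
    ... | false = refl

    step-fixesˡ : ∀ {K} u {v x} → Independent K J → J v ≡ true → step K u v x ≡ K v x
    step-fixesˡ {K} u J-ind Jv with J u in Ju
    ... | true  = ∗v-fixesˡ K u (J-ind _ u Jv Ju)
    ... | false = refl

    step-independent : ∀ {K} u → Independent K J → Independent (step K u) J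
    step-independent u J-ind x y Jx Jy = trans (step-fixesʳ u J-ind Jy) (J-ind x y Jx Jy)

    fold-diag : ∀ l K x → foldl step K l x x ≡ K x x
    fold-diag []      K x = refl
    fold-diag (u ∷ l) K x = trans (fold-diag l (step K u) x) (step-diag K u x)

    fold-cong : ∀ l {K K′} → K ≈G K′ → foldl step K l ≈G foldl step K′ l
    fold-cong []      K≈K′ = K≈K′
    fold-cong (u ∷ l) K≈K′ = fold-cong l (step-cong u K≈K′)

    fold-off : ∀ {m} (f : Fin m → Fin n) K → Independent K J → ∀ {x y} → x ≢ y →
               foldl step K (tabulate f) x y ≡ K x y xor sum (λ i → J (f i) ∧ (K x (f i) ∧ K (f i) y))
    fold-off {zero}  f K J-ind x≢y = sym (xor-identityʳ _)
    fold-off {suc m} f K J-ind {x} {y} x≢y = begin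
      foldl step K′ (tabulate (f ∘ suc)) x y
        ≡⟨ fold-off (f ∘ suc) K′ (step-independent (f zero) J-ind) x≢y ⟩
      K′ x y xor sum (λ i → J (f (suc i)) ∧ (K′ x (f (suc i)) ∧ K′ (f (suc i)) y))
        ≡⟨ cong₂ _xor_ (step-off K (f zero) x≢y)
                       (sum-∧-cong (J ∘ f ∘ suc) λ i Jv →
                         cong₂ _∧_ (step-fixesʳ (f zero) J-ind Jv) (step-fixesˡ (f zero) J-ind Jv)) ⟩
      (K x y xor (J (f zero) ∧ (K x (f zero) ∧ K (f zero) y)))
        xor sum (λ i → J (f (suc i)) ∧ (K x (f (suc i)) ∧ K (f (suc i)) y))
        ≡⟨ xor-assoc (K x y) _ (sum (λ i → J (f (suc i)) ∧ (K x (f (suc i)) ∧ K (f (suc i)) y))) ⟩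
      K x y xor sum (λ i → J (f i) ∧ (K x (f i) ∧ K (f i) y))
        ∎
      where K′ = step K (f zero)

∗-diag : ∀ {n} (K : Adj n) (J : VSet n) x → (K ∗ J) x x ≡ K x x
∗-diag K J = Fold.fold-diag J (allFin _) K

∗-cong : ∀ {n} {K K′ : Adj n} {J : VSet n} → K ≈G K′ → (K ∗ J) ≈G (K′ ∗ J)
∗-cong {J = J} = Fold.fold-cong J (allFin _)

∗-off : ∀ {n} {K : Adj n} {J : VSet n} → Independent K J → ∀ {x y} → x ≢ y →
        (K ∗ J) x y ≡ K x y xor codegree K J x y
∗-off {J = J} J-ind = Fold.fold-off J id _ J-ind

∗-fixesʳ : ∀ {n} {K : Adj n} {R J : VSet n} → Independent K R → J ⊆ R →
           ∀ x {v} → R v ≡ true → (K ∗ J) x v ≡ K x v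
∗-fixesʳ {K = K} {R} {J} R-ind J⊆R x {v} Rv with x ≟ v
... | yes refl = ∗-diag K J x
... | no  x≢v  = begin
  (K ∗ J) x v                ≡⟨ ∗-off (independent-⊆ J⊆R R-ind) x≢v ⟩
  K x v xor codegree K J x v ≡⟨ cong (K x v xor_) (codegree-zeroʳ K J λ w Jw → R-ind w v (J⊆R w Jw) Rv) ⟩
  K x v xor false            ≡⟨ xor-identityʳ (K x v) ⟩
  K x v                      ∎

∗-fixesˡ : ∀ {n} {K : Adj n} {R J : VSet n} → Independent K R → J ⊆ R →
           ∀ {v} x → R v ≡ true → (K ∗ J) v x ≡ K v x
∗-fixesˡ {K = K} {R} {J} R-ind J⊆R {v} x Rv with v ≟ x
... | yes refl = ∗-diag K J x
... | no  v≢x  = begin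
  (K ∗ J) v x                ≡⟨ ∗-off (independent-⊆ J⊆R R-ind) v≢x ⟩
  K v x xor codegree K J v x ≡⟨ cong (K v x xor_) (codegree-zeroˡ K J λ w Jw → R-ind v w Rv (J⊆R w Jw)) ⟩
  K v x xor false            ≡⟨ xor-identityʳ (K v x) ⟩
  K v x                      ∎

∗-independent : ∀ {n} {K : Adj n} {R J : VSet n} → Independent K R → J ⊆ R → Independent (K ∗ J) R
∗-independent R-ind J⊆R x y Rx Ry = trans (∗-fixesʳ R-ind J⊆R x Ry) (R-ind x y Rx Ry)

∗-empty : ∀ {n} {K : Adj n} {J : VSet n} → Empty J → (K ∗ J) ≈G K
∗-empty {K = K} {J} J-empty = ≈G-by-cases (∗-diag K J) λ {x} {y} x≢y → begin
  (K ∗ J) x y                ≡⟨ ∗-off (empty-independent J-empty) x≢y ⟩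
  K x y xor codegree K J x y ≡⟨ cong (K x y xor_) (sum-zero λ v → cong (_∧ (K x v ∧ K v y)) (J-empty v)) ⟩
  K x y xor false            ≡⟨ xor-identityʳ (K x y) ⟩
  K x y                      ∎

∗-symmetric : ∀ {n} {K : Adj n} {J : VSet n} → Symmetric K → Independent K J → Symmetric (K ∗ J)
∗-symmetric {K = K} {J} K-sym J-ind x y with x ≟ y
... | yes refl = refl
... | no  x≢y  = begin
  (K ∗ J) x y                ≡⟨ ∗-off J-ind x≢y ⟩
  K x y xor codegree K J x y ≡⟨ cong₂ _xor_ (K-sym x y) (sum-cong-≗ λ v → cong (J v ∧_) (reverse v)) ⟩
  K y x xor codegree K J y x ≡⟨ sym (∗-off J-ind (x≢y ∘ sym)) ⟩
  (K ∗ J) y x                ∎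
  where
  reverse : ∀ v → K x v ∧ K v y ≡ K y v ∧ K v x
  reverse v = trans (∧-comm (K x v) (K v y)) (cong₂ _∧_ (K-sym v y) (K-sym x v))

∗-∖ : ∀ {n} {K : Adj n} {R J : VSet n} → Independent K R → J ⊆ R → ((K ∗ R) ∗ J) ≈G (K ∗ (R ∖ J))
∗-∖ {K = K} {R} {J} R-ind J⊆R = ≈G-by-cases diag off
  where
  diag : ∀ x → ((K ∗ R) ∗ J) x x ≡ (K ∗ (R ∖ J)) x x
  diag x = trans (∗-diag (K ∗ R) J x) (trans (∗-diag K R x) (sym (∗-diag K (R ∖ J) x)))
  off : ∀ {x y} → x ≢ y → ((K ∗ R) ∗ J) x y ≡ (K ∗ (R ∖ J)) x y
  off {x} {y} x≢y = begin
    ((K ∗ R) ∗ J) x y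
      ≡⟨ ∗-off (independent-⊆ J⊆R (∗-independent R-ind ⊆-refl)) x≢y ⟩
    (K ∗ R) x y xor codegree (K ∗ R) J x y
      ≡⟨ cong₂ _xor_ (∗-off R-ind x≢y)
                     (sum-∧-cong J λ v Jv → cong₂ _∧_ (∗-fixesʳ R-ind ⊆-refl x (J⊆R v Jv))
                                                       (∗-fixesˡ R-ind ⊆-refl y (J⊆R v Jv))) ⟩
    (K x y xor codegree K R x y) xor codegree K J x y
      ≡⟨ xor-assoc (K x y) (codegree K R x y) (codegree K J x y) ⟩
    K x y xor (codegree K R x y xor codegree K J x y)
      ≡⟨ cong (K x y xor_) (sym (codegree-∖ K J⊆R x y)) ⟩
    K x y xor codegree K (R ∖ J) x y
      ≡⟨ sym (∗-off (independent-⊆ ∖-⊆ R-ind) x≢y) ⟩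
    (K ∗ (R ∖ J)) x y
      ∎

∗-involutive : ∀ {n} {K : Adj n} {J : VSet n} → Independent K J → ((K ∗ J) ∗ J) ≈G K
∗-involutive {K = K} {J} J-ind =
  ≈G.trans (∗-∖ J-ind ⊆-refl) (∗-empty {K = K} {J ∖ J} λ x → ∧-inverseʳ (J x))

foldl-∗-cong : ∀ {n} (Js : List (VSet n)) {K K′ : Adj n} → K ≈G K′ → foldl _∗_ K Js ≈G foldl _∗_ K′ Js
foldl-∗-cong []       K≈K′ = K≈K′
foldl-∗-cong (J ∷ Js) K≈K′ = foldl-∗-cong Js (∗-cong {J = J} K≈K′)

-- Flips with arbitrary labels

-- Refining such a flip needs no re-encoding into Fin until the very end (toFlip).
record LabelledFlip (n : ℕ) (L : Set) : Set where
  field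
    label  : Fin n → L
    τᴸ     : L → L → Bool
    τᴸ-sym : ∀ a b → τᴸ a b ≡ τᴸ b a
open LabelledFlip public

_⊕ᴸ_ : ∀ {n L} → Adj n → LabelledFlip n L → Adj n
(E ⊕ᴸ Φ) x y = if does (x ≟ y) then E x y else (E x y xor τᴸ Φ (label Φ x) (label Φ y))

⊕ᴸ-diag : ∀ {n L} (E : Adj n) (Φ : LabelledFlip n L) x → (E ⊕ᴸ Φ) x x ≡ E x x
⊕ᴸ-diag E Φ x = if-≟-refl x

⊕ᴸ-off : ∀ {n L} (E : Adj n) (Φ : LabelledFlip n L) {x y} → x ≢ y →
         (E ⊕ᴸ Φ) x y ≡ E x y xor τᴸ Φ (label Φ x) (label Φ y)
⊕ᴸ-off E Φ = if-≟-≢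

⊕ᴸ-cong : ∀ {n L} {E E′ : Adj n} (Φ : LabelledFlip n L) → E ≈G E′ → (E ⊕ᴸ Φ) ≈G (E′ ⊕ᴸ Φ)
⊕ᴸ-cong Φ E≈E′ x y rewrite E≈E′ x y = refl

-- The correction term is what remains of Σ_{v ∈ J} (H x v + τ(x, d)) (H v y + τ(d, y))
-- after removing Σ_{v ∈ J} H x v H v y; it is only needed when x, y ∉ J.
refine : ∀ {n L} → LabelledFlip n L → Adj n → VSet n → L → LabelledFlip n (L × Bool × Bool)
refine {L = L} Φ H J d = record
  { label  = λ x → label Φ x , J x , degree H J x
  ; τᴸ     = τ′
  ; τᴸ-sym = τ′-sym
  }
  where
  τ′ : L × Bool × Bool → L × Bool × Bool → Bool
  τ′ (a , j , s) (b , j′ , s′) =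
    τᴸ Φ a b xor (not j ∧ (not j′ ∧
      (((τᴸ Φ a d ∧ s′) xor (τᴸ Φ b d ∧ s)) xor (parity J ∧ (τᴸ Φ a d ∧ τᴸ Φ b d)))))
  τ′-sym : ∀ p q → τ′ p q ≡ τ′ q p
  τ′-sym (a , j , s) (b , j′ , s′) =
    cong₂ _xor_ (τᴸ-sym Φ a b) (swap (not j) (not j′) (τᴸ Φ a d) (τᴸ Φ b d) s s′ (parity J))
    where
    swap : ∀ i i′ α β s s′ N →
      i ∧ (i′ ∧ (((α ∧ s′) xor (β ∧ s)) xor (N ∧ (α ∧ β))))
      ≡ i′ ∧ (i ∧ (((β ∧ s) xor (α ∧ s′)) xor (N ∧ (β ∧ α))))
    swap = solve-∀ 𝔽₂

∉-≢ : ∀ {n} {J : VSet n} {x v} → J x ≡ false → J v ≡ true → x ≢ v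
∉-≢ Jx Jv refl = contradiction (trans (sym Jv) Jx) λ ()

codegree-⊕ᴸ : ∀ {n L} {H : Adj n} (Φ : LabelledFlip n L) {J : VSet n} {d : L} → Symmetric H →
  (∀ v → J v ≡ true → label Φ v ≡ d) → ∀ {x y} → J x ≡ false → J y ≡ false →
  codegree (H ⊕ᴸ Φ) J x y
  ≡ (codegree H J x y xor (τᴸ Φ (label Φ x) d ∧ degree H J y))
    xor ((τᴸ Φ (label Φ y) d ∧ degree H J x) xor (τᴸ Φ (label Φ x) d ∧ (τᴸ Φ (label Φ y) d ∧ parity J)))
codegree-⊕ᴸ {H = H} Φ {J} {d} H-sym J-label {x} {y} Jx Jy = begin
  codegree (H ⊕ᴸ Φ) J x y
    ≡⟨ sum-∧-cong J (λ v Jv → cong₂ _∧_ (from-x v Jv) (to-y v Jv)) ⟩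
  sum (λ v → J v ∧ ((H x v xor α) ∧ (H v y xor β)))
    ≡⟨ sum-∧-affine J (H x) (λ v → H v y) α β ⟩
  (codegree H J x y xor (α ∧ sum (λ v → J v ∧ H v y))) xor ((β ∧ degree H J x) xor (α ∧ (β ∧ parity J)))
    ≡⟨ cong (λ s → (codegree H J x y xor (α ∧ s)) xor ((β ∧ degree H J x) xor (α ∧ (β ∧ parity J))))
            (sum-cong-≗ λ v → cong (J v ∧_) (H-sym v y)) ⟩
  (codegree H J x y xor (α ∧ degree H J y)) xor ((β ∧ degree H J x) xor (α ∧ (β ∧ parity J)))
    ∎
  where
  α = τᴸ Φ (label Φ x) d
  β = τᴸ Φ (label Φ y) d
  from-x : ∀ v → J v ≡ true → (H ⊕ᴸ Φ) x v ≡ H x v xor α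
  from-x v Jv = trans (⊕ᴸ-off H Φ (∉-≢ Jx Jv)) (cong (λ l → H x v xor τᴸ Φ (label Φ x) l) (J-label v Jv))
  to-y : ∀ v → J v ≡ true → (H ⊕ᴸ Φ) v y ≡ H v y xor β
  to-y v Jv = trans (⊕ᴸ-off H Φ (∉-≢ Jy Jv ∘ sym))
                    (cong (H v y xor_) (trans (cong (λ l → τᴸ Φ l (label Φ y)) (J-label v Jv))
                                              (τᴸ-sym Φ d (label Φ y))))

⊕ᴸ-∗ : ∀ {n L} {H : Adj n} (Φ : LabelledFlip n L) {J : VSet n} {d : L} → Symmetric H →
       (∀ v → J v ≡ true → label Φ v ≡ d) → Independent H J → Independent (H ⊕ᴸ Φ) J →
       ((H ⊕ᴸ Φ) ∗ J) ≈G ((H ∗ J) ⊕ᴸ refine Φ H J d)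
⊕ᴸ-∗ {H = H} Φ {J} {d} H-sym J-label H-ind HΦ-ind = ≈G-by-cases diag off
  where
  Φ′ = refine Φ H J d
  diag : ∀ x → ((H ⊕ᴸ Φ) ∗ J) x x ≡ ((H ∗ J) ⊕ᴸ Φ′) x x
  diag x = trans (∗-diag (H ⊕ᴸ Φ) J x)
                 (trans (⊕ᴸ-diag H Φ x) (sym (trans (⊕ᴸ-diag (H ∗ J) Φ′ x) (∗-diag H J x))))
  regroup : ∀ h t C α β dx dy N →
    (h xor t) xor ((C xor (α ∧ dy)) xor ((β ∧ dx) xor (α ∧ (β ∧ N))))
    ≡ (h xor C) xor (t xor (((α ∧ dy) xor (β ∧ dx)) xor (N ∧ (α ∧ β))))
  regroup = solve-∀ 𝔽₂
  unchanged : ∀ h t {CΦ C} → CΦ ≡ false → C ≡ false → (h xor t) xor CΦ ≡ (h xor C) xor (t xor false)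
  unchanged h t refl refl = trans (xor-identityʳ (h xor t))
                                  (sym (cong₂ _xor_ (xor-identityʳ h) (xor-identityʳ t)))
  t : Fin _ → Fin _ → Bool
  t x y = τᴸ Φ (label Φ x) (label Φ y)
  α : Fin _ → Bool
  α x = τᴸ Φ (label Φ x) d
  middle : ∀ {x y} → x ≢ y →
    (H x y xor t x y) xor codegree (H ⊕ᴸ Φ) J x y
    ≡ (H x y xor codegree H J x y)
      xor (t x y xor (not (J x) ∧ (not (J y) ∧
        (((α x ∧ degree H J y) xor (α y ∧ degree H J x)) xor (parity J ∧ (α x ∧ α y))))))
  middle {x} {y} x≢y with J x in Jx | J y in Jy
  ... | true  | _     = unchanged (H x y) (t x y) (codegree-zeroˡ (H ⊕ᴸ Φ) J λ v Jv → HΦ-ind x v Jx Jv)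
                                                  (codegree-zeroˡ H J λ v Jv → H-ind x v Jx Jv)
  ... | false | true  = unchanged (H x y) (t x y) (codegree-zeroʳ (H ⊕ᴸ Φ) J λ v Jv → HΦ-ind v y Jv Jy)
                                                  (codegree-zeroʳ H J λ v Jv → H-ind v y Jv Jy)
  ... | false | false =
    trans (cong ((H x y xor t x y) xor_) (codegree-⊕ᴸ Φ H-sym J-label Jx Jy))
          (regroup (H x y) (t x y) (codegree H J x y) (α x) (α y) (degree H J x) (degree H J y) (parity J))
  off : ∀ {x y} → x ≢ y → ((H ⊕ᴸ Φ) ∗ J) x y ≡ ((H ∗ J) ⊕ᴸ Φ′) x y
  off {x} {y} x≢y = begin
    ((H ⊕ᴸ Φ) ∗ J) x y
      ≡⟨ ∗-off HΦ-ind x≢y ⟩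
    (H ⊕ᴸ Φ) x y xor codegree (H ⊕ᴸ Φ) J x y
      ≡⟨ cong (_xor codegree (H ⊕ᴸ Φ) J x y) (⊕ᴸ-off H Φ x≢y) ⟩
    (H x y xor t x y) xor codegree (H ⊕ᴸ Φ) J x y
      ≡⟨ middle x≢y ⟩
    (H x y xor codegree H J x y) xor τᴸ Φ′ (label Φ′ x) (label Φ′ y)
      ≡⟨ cong (_xor τᴸ Φ′ (label Φ′ x) (label Φ′ y)) (sym (∗-off H-ind x≢y)) ⟩
    (H ∗ J) x y xor τᴸ Φ′ (label Φ′ x) (label Φ′ y)
      ≡⟨ sym (⊕ᴸ-off (H ∗ J) Φ′ x≢y) ⟩
    ((H ∗ J) ⊕ᴸ Φ′) x y
      ∎

fromFlip : ∀ {n k} → Flip n k → LabelledFlip n (Fin k)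
fromFlip F = record { label = ι F ; τᴸ = τ F ; τᴸ-sym = τ-sym F }

toFlip : ∀ {n m L} → LabelledFlip n L → L ↪ Fin m → Flip n m
toFlip Φ e = record
  { ι     = to ∘ label Φ
  ; τ     = λ i j → τᴸ Φ (from i) (from j)
  ; τ-sym = λ i j → τᴸ-sym Φ (from i) (from j)
  }
  where open RightInverse e

⊕-toFlip : ∀ {n m L} (E : Adj n) (Φ : LabelledFlip n L) (e : L ↪ Fin m) → (E ⊕ toFlip Φ e) ≈G (E ⊕ᴸ Φ)
⊕-toFlip E Φ e x y
  rewrite RightInverse.strictlyInverseʳ e (label Φ x) | RightInverse.strictlyInverseʳ e (label Φ y) = refl

×Bool²-↪ : ∀ {L : Set} {m} → L ↪ Fin m → (L × Bool × Bool) ↪ Fin (m * 4)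
×Bool²-↪ e = ↔⇒↪ (↔-sym *↔×) ↪-∘ (e ×-↪ ↔⇒↪ (↔-sym *↔× ↔-∘ (↔-sym 2↔Bool ×-↔ ↔-sym 2↔Bool)))

data Peeling {n : ℕ} : Adj n → VSet n → List (VSet n) → Set where
  done : ∀ {K R} → Empty R → Peeling K R []
  peel : ∀ {K R J Js} → (∃ λ v → J v ≡ true) → J ⊆ R → Independent K J →
         Peeling (K ∗ J) (R ∖ J) Js → Peeling K R (J ∷ Js)

Peeling-cong : ∀ {n} {K K′ : Adj n} {R R′ : VSet n} {Js} →
               K ≈G K′ → (∀ x → R x ≡ R′ x) → Peeling K R Js → Peeling K′ R′ Js
Peeling-cong K≈K′ R≗R′ (done R-empty) = done λ x → trans (sym (R≗R′ x)) (R-empty x)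
Peeling-cong {Js = J ∷ _} K≈K′ R≗R′ (peel J-nonempty J⊆R J-ind rest) =
  peel J-nonempty (λ x Jx → trans (sym (R≗R′ x)) (J⊆R x Jx)) (independent-≈ K≈K′ J-ind)
       (Peeling-cong (∗-cong {J = J} K≈K′) (λ x → cong (_∧ not (J x)) (R≗R′ x)) rest)

Peeling⇒nonempty : ∀ {n} {K : Adj n} {R Js} → Peeling K R Js → ∀ j → ∃ λ v → lookup Js j v ≡ true
Peeling⇒nonempty (peel J-nonempty _ _ _) zero    = J-nonempty
Peeling⇒nonempty (peel _ _ _ rest)       (suc j) = Peeling⇒nonempty rest j

Peeling⇒⊆ : ∀ {n} {K : Adj n} {R Js} → Peeling K R Js → ∀ j → lookup Js j ⊆ R
Peeling⇒⊆ (peel _ J⊆R _ _) zero    = J⊆R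
Peeling⇒⊆ (peel {R = R} {J} _ _ _ rest) (suc j) = λ v v∈ → ∖-⊆ {R = R} {J} v (Peeling⇒⊆ rest j v v∈)

Peeling⇒cover : ∀ {n} {K : Adj n} {R Js} → Peeling K R Js → ∀ v → R v ≡ true →
  ∃ λ j → lookup Js j v ≡ true × (∀ j′ → lookup Js j′ v ≡ true → j′ ≡ j)
Peeling⇒cover (done R-empty) v Rv = contradiction (trans (sym Rv) (R-empty v)) λ ()
Peeling⇒cover {R = R} (peel {J = J} {Js} _ _ _ rest) v Rv with J v in Jv
... | true  = zero , Jv , unique
  where
  unique : ∀ j′ → lookup (J ∷ Js) j′ v ≡ true → j′ ≡ zero
  unique zero     _  = refl
  unique (suc j′) v∈ = contradiction (trans (sym Jv) (proj₂ (∈-∖⁻ R J v (Peeling⇒⊆ rest j′ v v∈)))) λ ()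
... | false with Peeling⇒cover rest v (∈-∖⁺ R J Rv Jv)
...   | j , v∈ , unique = suc j , v∈ , unique′
  where
  unique′ : ∀ j′ → lookup (J ∷ Js) j′ v ≡ true → j′ ≡ suc j
  unique′ zero      v∈J  = contradiction (trans (sym v∈J) Jv) λ ()
  unique′ (suc j′)  v∈j′ = cong suc (unique j′ v∈j′)

Peeling⇒IsPartition : ∀ {n} {K : Adj n} {R Js} → Peeling K R Js → IsPartition (length Js) (lookup Js) R
Peeling⇒IsPartition P = Peeling⇒nonempty P , Peeling⇒⊆ P , Peeling⇒cover P

applyParts-suc : ∀ {n} p (H : Adj n) (I : Fin (suc p) → VSet n) →
                 applyParts (suc p) H I ≡ applyParts p H (I ∘ suc) ∗ I zero
applyParts-suc zero    H I = refl
applyParts-suc (suc p) H I = applyParts-suc p (H ∗ I (fromℕ (suc p))) (I ∘ inject₁)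

applyParts-cong : ∀ {n} p {H H′ : Adj n} I → H ≈G H′ → applyParts p H I ≈G applyParts p H′ I
applyParts-cong zero    I H≈H′ = H≈H′
applyParts-cong (suc p) I H≈H′ = applyParts-cong p (I ∘ inject₁) (∗-cong {J = I (fromℕ p)} H≈H′)

applyParts-foldl : ∀ {n} {K : Adj n} {R Js} → Peeling K R Js → applyParts (length Js) (foldl _∗_ K Js) (lookup Js) ≈G K
applyParts-foldl (done _) = ≈G.refl
applyParts-foldl {K = K} (peel {J = J} {Js} _ _ J-ind rest) x y =
  trans (cong (λ E → E x y) (applyParts-suc (length Js) (foldl _∗_ (K ∗ J) Js) (lookup (J ∷ Js))))
        (trans (∗-cong {J = J} (applyParts-foldl rest) x y) (∗-involutive J-ind x y))

PartsIndependent-suc : ∀ {n} p (H : Adj n) I → PartsIndependent p H (I ∘ suc) →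
                       Independent (applyParts p H (I ∘ suc)) (I zero) → PartsIndependent (suc p) H I
PartsIndependent-suc zero    H I _              last-ind = last-ind , tt
PartsIndependent-suc (suc p) H I (first-ind , rest) last-ind =
  first-ind , PartsIndependent-suc p (H ∗ I (fromℕ (suc p))) (I ∘ inject₁) rest last-ind

PartsIndependent-cong : ∀ {n} p {H H′ : Adj n} I → H ≈G H′ → PartsIndependent p H I → PartsIndependent p H′ I
PartsIndependent-cong zero    I _    _               = tt
PartsIndependent-cong (suc p) I H≈H′ (first-ind , rest) =
  independent-≈ H≈H′ first-ind ,
  PartsIndependent-cong p (I ∘ inject₁) (∗-cong {J = I (fromℕ p)} H≈H′) rest

Peeling⇒PartsIndependent : ∀ {n} {K : Adj n} {R Js} → Peeling K R Js →
                           PartsIndependent (length Js) (foldl _∗_ K Js) (lookup Js)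
Peeling⇒PartsIndependent (done _) = tt
Peeling⇒PartsIndependent {K = K} (peel {J = J} {Js} _ _ J-ind rest) =
  PartsIndependent-suc (length Js) (foldl _∗_ (K ∗ J) Js) (lookup (J ∷ Js))
    (Peeling⇒PartsIndependent rest)
    (independent-≈ (≈G.sym (applyParts-foldl rest)) (∗-independent J-ind ⊆-refl))

record Peeled {n : ℕ} (G K : Adj n) (R : VSet n) (p f : ℕ) : Set where
  field
    parts   : List (VSet n)
    peeling : Peeling K R parts
    length≤ : length parts ≤ p
    F′      : Flip n f
    result  : foldl _∗_ K parts ≈G (G ⊕ F′)

Peeled-cons : ∀ {n} {G K : Adj n} {R J : VSet n} {p f} → J ⊆ R → Independent K J →
              Peeled G (K ∗ J) (R ∖ J) p f → Peeled G K R (suc p) f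
Peeled-cons {J = J} J⊆R J-ind P with any? (λ v → J v ≟ᵇ true)
... | yes J-nonempty = record
  { parts   = J ∷ parts
  ; peeling = peel J-nonempty J⊆R J-ind peeling
  ; length≤ = s≤s length≤
  ; F′      = F′
  ; result  = result
  }
  where open Peeled P
... | no ∄ = record
  { parts   = parts
  ; peeling = Peeling-cong (∗-empty J-empty) (∖-empty J-empty) peeling
  ; length≤ = m≤n⇒m≤1+n length≤
  ; F′      = F′
  ; result  = ≈G.trans (foldl-∗-cong parts (≈G.sym (∗-empty J-empty))) result
  }
  where
  open Peeled P
  J-empty : Empty J
  J-empty v with J v in Jv
  ... | true  = contradiction (v , Jv) ∄
  ... | false = refl

16^-suc : ∀ m l → m * 4 * 4 * 16 ^ l ≡ m * 16 ^ suc l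
16^-suc m l = trans (*-assoc (m * 4) 4 (16 ^ l))
                    (trans (*-assoc m 4 (4 * 16 ^ l)) (cong (m *_) (sym (*-assoc 4 4 (16 ^ l)))))

-- Peeling the colour classes of a flip

module ColourPeeling {n k : ℕ} (G : Adj n) (G-sym : Symmetric G) (G-irr : ∀ x → G x x ≡ false) (F : Flip n k) where

  colourClass : VSet n → Fin k → VSet n
  colourClass R c x = R x ∧ does (ι F x ≟ c)

  colourClass-⊆ : ∀ R c → colourClass R c ⊆ R
  colourClass-⊆ R c x = ∧-conicalˡ (R x) _

  colourClass-colour : ∀ R c {x} → colourClass R c x ≡ true → ι F x ≡ c
  colourClass-colour R c {x} x∈ = does-≟⇒≡ (∧-conicalʳ (R x) _ x∈)

  colourClass-mono : ∀ {R R′} c → R′ ⊆ R → colourClass R′ c ⊆ colourClass R c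
  colourClass-mono {R′ = R′} c R′⊆R x x∈ = cong₂ _∧_ (R′⊆R x (∧-conicalˡ (R′ x) _ x∈)) (∧-conicalʳ (R′ x) _ x∈)

  record Stage (K : Adj n) (R : VSet n) (m : ℕ) : Set₁ where
    field
      {L}           : Set
      Φ             : LabelledFlip n L
      finite        : L ↪ Fin m
      colourLabel   : Fin k → L
      K≈            : K ≈G ((G ∗ R) ⊕ᴸ Φ)
      R-independent : Independent G R
      label-R       : ∀ x → R x ≡ true → label Φ x ≡ colourLabel (ι F x)

    label-class : ∀ c {x} → colourClass R c x ≡ true → label Φ x ≡ colourLabel c
    label-class c x∈ = trans (label-R _ (colourClass-⊆ R c _ x∈)) (cong colourLabel (colourClass-colour R c x∈))

    GR-independent : Independent (G ∗ R) R
    GR-independent = ∗-independent R-independent ⊆-refl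

    K-irreflexive : ∀ x → K x x ≡ false
    K-irreflexive x = trans (K≈ x x) (trans (⊕ᴸ-diag (G ∗ R) Φ x) (trans (∗-diag G R x) (G-irr x)))

    colourClass-independent : ∀ c →
      (∀ u → colourClass R c u ≡ true → τᴸ Φ (colourLabel c) (colourLabel c) ≡ false) →
      Independent K (colourClass R c)
    colourClass-independent c τ-false u w u∈ w∈ with u ≟ w
    ... | yes refl = K-irreflexive u
    ... | no  u≢w  = begin
      K u w                                        ≡⟨ K≈ u w ⟩
      ((G ∗ R) ⊕ᴸ Φ) u w                           ≡⟨ ⊕ᴸ-off (G ∗ R) Φ u≢w ⟩
      (G ∗ R) u w xor τᴸ Φ (label Φ u) (label Φ w)
        ≡⟨ cong₂ _xor_ (GR-independent u w (colourClass-⊆ R c u u∈) (colourClass-⊆ R c w w∈))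
                       (cong₂ (τᴸ Φ) (label-class c u∈) (label-class c w∈)) ⟩
      τᴸ Φ (colourLabel c) (colourLabel c)         ≡⟨ τ-false u u∈ ⟩
      false                                        ∎

  Stage-∗ : ∀ {K R m J c} → Stage K R m → J ⊆ colourClass R c → Independent K J → Stage (K ∗ J) (R ∖ J) (m * 4)
  Stage-∗ {K} {R} {m} {J} {c} st J⊆class J-ind = record
    { Φ             = Φ′
    ; finite        = ×Bool²-↪ finite
    ; colourLabel   = λ c′ → colourLabel c′ , false , false
    ; K≈            = ≈G.trans (∗-cong {J = J} K≈) (≈G.trans commute (⊕ᴸ-cong Φ′ (∗-∖ R-independent J⊆R)))
    ; R-independent = independent-⊆ ∖-⊆ R-independent
    ; label-R       = label-R′
    }
    where
    open Stage st
    J⊆R : J ⊆ R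
    J⊆R x Jx = colourClass-⊆ R c x (J⊆class x Jx)
    Φ′ = refine Φ (G ∗ R) J (colourLabel c)
    commute : (((G ∗ R) ⊕ᴸ Φ) ∗ J) ≈G (((G ∗ R) ∗ J) ⊕ᴸ Φ′)
    commute = ⊕ᴸ-∗ Φ (∗-symmetric G-sym R-independent) (λ v Jv → label-class c (J⊆class v Jv))
                     (independent-⊆ J⊆R GR-independent) (independent-≈ K≈ J-ind)
    label-R′ : ∀ x → (R ∖ J) x ≡ true → label Φ′ x ≡ (colourLabel (ι F x) , false , false)
    label-R′ x x∈ with ∈-∖⁻ R J x x∈
    ... | Rx , Jx = cong₂ _,_ (label-R x Rx)
                              (cong₂ _,_ Jx (sum-∧-zero J λ v Jv → GR-independent x v Rx (J⊆R v Jv)))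

  flip-cancelled : ∀ t → t xor (((t ∧ false) xor (t ∧ false)) xor (true ∧ (t ∧ t))) ≡ false
  flip-cancelled false = refl
  flip-cancelled true  = refl

  peelColours : ∀ (cs : List (Fin k)) {K R m} → Stage K R m → (∀ x → R x ≡ true → ι F x ∈ cs) →
                Peeled G K R (2 * length cs) (m * 16 ^ length cs)
  peelColours [] {K} {R} {m} st R⊆[] = record
    { parts   = []
    ; peeling = done R-empty
    ; length≤ = z≤n
    ; F′      = toFlip Φ finite′
    ; result  = ≈G.trans K≈ (≈G.trans (⊕ᴸ-cong Φ (∗-empty R-empty)) (≈G.sym (⊕-toFlip G Φ finite′)))
    }
    where
    open Stage st
    finite′ = subst (λ N → L ↪ Fin N) (sym (*-identityʳ m)) finite
    R-empty : Empty R
    R-empty x with R x in Rx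
    ... | true  = contradiction (R⊆[] x Rx) λ ()
    ... | false = refl
  peelColours (c ∷ cs) {K} {R} {m} st R⊆c∷cs =
    subst₂ (Peeled G K R) (sym (*-suc 2 (length cs))) (16^-suc m (length cs))
      (Peeled-cons (λ x x∈ → colourClass-⊆ R c x (J₁⊆class x x∈)) J₁-ind
        (Peeled-cons (colourClass-⊆ (R ∖ J₁) c) J₂-ind (peelColours cs st₂ R₂⊆cs)))
    where
    open Stage st
    d = colourLabel c
    J₁ = pick (colourClass R c)
    J₁⊆class : J₁ ⊆ colourClass R c
    J₁⊆class = pick-⊆
    J₁-ind : Independent K J₁
    J₁-ind = subsingleton-independent K-irreflexive pick-subsingleton
    st₁ = Stage-∗ st J₁⊆class J₁-ind
    J₂ = colourClass (R ∖ J₁) c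
    -- Complementing at the single vertex of J₁ adds parity J₁ = 1 to τ(c, c), so the rest of
    -- the class is independent now even if it was a clique.
    J₂-ind : Independent (K ∗ J₁) J₂
    J₂-ind = Stage.colourClass-independent st₁ c λ u u∈ →
      trans (cong (λ N → τᴸ Φ d d xor (((τᴸ Φ d d ∧ false) xor (τᴸ Φ d d ∧ false)) xor (N ∧ (τᴸ Φ d d ∧ τᴸ Φ d d))))
                  (parity-pick {P = colourClass R c} (colourClass-mono c (∖-⊆ {R = R} {J₁}) u u∈)))
            (flip-cancelled (τᴸ Φ d d))
    st₂ = Stage-∗ st₁ (λ _ x∈ → x∈) J₂-ind
    R₂⊆cs : ∀ x → ((R ∖ J₁) ∖ J₂) x ≡ true → ι F x ∈ cs
    R₂⊆cs x x∈ with ∈-∖⁻ (R ∖ J₁) J₂ x x∈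
    ... | x∈R₁ , x∉J₂ with R⊆c∷cs x (∖-⊆ {R = R} {J₁} x x∈R₁)
    ...   | here  x≡c  = contradiction (trans (sym x∉J₂) (cong₂ _∧_ x∈R₁ (dec-true (ι F x ≟ c) x≡c))) λ ()
    ...   | there x∈cs = x∈cs

  initialStage : ∀ {I} → Independent G I → Stage ((G ∗ I) ⊕ F) I k
  initialStage I-ind = record
    { Φ             = fromFlip F
    ; finite        = ↪-id (Fin k)
    ; colourLabel   = id
    ; K≈            = λ _ _ → refl
    ; R-independent = I-ind
    ; label-R       = λ _ _ → refl
    }

  peelings : ∀ {I} → Independent G I → Peeled G ((G ∗ I) ⊕ F) I (2 * k) (k * 16 ^ k)
  peelings {I} I-ind = subst (λ l → Peeled G ((G ∗ I) ⊕ F) I (2 * l) (k * 16 ^ l)) (length-tabulate {n = k} id)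
                         (peelColours (allFin k) (initialStage I-ind) (λ x _ → ∈-allFin (ι F x)))

corollary7 : Σ (ℕ → ℕ) λ f →
    ∀ (n k : ℕ) (G : Adj n) → IsSimpleGraph G → (F : Flip n k) (I : VSet n) →
    Independent G I →
    ∃ λ (p : ℕ) → Σ (Fin p → VSet n) λ parts → Σ (Flip n (f k)) λ F' →
      p ≤ 2 * k × IsPartition p parts I ×
      PartsIndependent p (G ⊕ F') parts ×
      (applyParts p (G ⊕ F') parts ≈G ((G ∗ I) ⊕ F))
corollary7 = (λ k → k * 16 ^ k) , λ n k G (G-sym , G-irr) F I I-ind →
  let open Peeled (ColourPeeling.peelings G G-sym G-irr F I-ind) in
  length parts , lookup parts , F′ , length≤ , Peeling⇒IsPartition peeling ,
  PartsIndependent-cong (length parts) (lookup parts) result (Peeling⇒PartsIndependent peeling) ,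
  ≈G.trans (applyParts-cong (length parts) (lookup parts) (≈G.sym result)) (applyParts-foldl peeling)
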